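{- Let $p$ be an odd prime. Then for every nonnegative integer $n$, $$\tau_{2p}(n+1)\equiv\sum_{\substack{(r,s)\in\mathbb{Z}^2\\ n=p\left(\frac{r(3r-1)}{2}+\frac{s(3s-1)}{2}\right)}}(-1)^{r+s}\pmod p.$$
   Context: For a nonzero integer $k$, $\tau_k$ is defined by $q\prod_{m=1}^{\infty}(1-q^m)^k=\sum_{n=1}^{\infty}\tau_k(n)q^n$. The numbers $\frac{j(3j-1)}{2}$, $j\in\mathbb{Z}$, are the generalized pentagonal numbers $\frac{3l^2\pm l}{2}$, $l\ge0$. -}

module Defs where

open import Data.Nat as ℕ using (ℕ; zero; suc; _∸_)
open import Data.Nat.Properties using (_≤?_)
open import Data.Integer as ℤ using (ℤ; +_; -_; _-_; ∣_∣)
open import Data.Integer.DivMod using (_/_)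
open import Data.List using (List; map; upTo; foldr; concatMap)
open import Data.Bool using (if_then_else_)
open import Relation.Nullary using (yes; no)
open import Relation.Nullary.Decidable using (does)

Series : Set
Series = ℕ → ℤ

oneS : Series
oneS zero    = + 1
oneS (suc _) = + 0

-- multiply a series by (1 - q^m)
mulFactor : ℕ → Series → Series
mulFactor m f n with m ≤? n
... | yes _ = f n ℤ.- f (n ∸ m)
... | no _ = f n

powFactor : ℕ → ℕ → Series → Series
powFactor m zero    f = f
powFactor m (suc k) f = mulFactor m (powFactor m k f)

prodUpTo : ℕ → ℕ → Series
prodUpTo k zero    = oneS
prodUpTo k (suc N) = powFactor (suc N) k (prodUpTo k N)

-- coefficient of q^N in ∏_{m≥1} (1 - q^m)^k  (factors with m > N do not
-- affect this coefficient, so truncating the product at m = N is exact)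
etaPowCoeff : ℕ → ℕ → ℤ
etaPowCoeff k N = prodUpTo k N N

-- τ_k(n) defined by  q ∏_{m≥1} (1-q^m)^k = Σ_{n≥1} τ_k(n) q^n  (for k ∈ ℕ)
τ : ℕ → ℕ → ℤ
τ k zero    = + 0
τ k (suc n) = etaPowCoeff k n

pent : ℤ → ℤ
pent j = (j ℤ.* (+ 3 ℤ.* j - + 1)) / (+ 2)

negOnePowℕ : ℕ → ℤ
negOnePowℕ zero    = + 1
negOnePowℕ (suc n) = - negOnePowℕ n

negOnePow : ℤ → ℤ
negOnePow z = negOnePowℕ ∣ z ∣

rangeℤ : ℕ → List ℤ
rangeℤ B = map (λ i → + i - + B) (upTo (suc (2 ℕ.* B)))

sumℤ : List ℤ → ℤ
sumℤ = foldr ℤ._+_ (+ 0)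

-- Σ_{(r,s) ∈ ℤ², n = p (pent r + pent s)} (-1)^(r+s).
-- Since pent j ≥ |j| for all j, every solution has |r|,|s| ≤ n, so
-- summing over the box [-n,n]² enumerates all solutions exactly once.
pentSum : ℕ → ℕ → ℤ
pentSum p n =
  sumℤ (concatMap (λ r → map (λ s →
         if does (+ n ℤ.≟ + p ℤ.* (pent r ℤ.+ pent s))
         then negOnePow (r ℤ.+ s) else + 0) (rangeℤ n)) (rangeℤ n))

-- Modulo p, (1 - q^m)^{2p} ≡ (1 - q^{pm})^2, because the middle binomial coefficients of (1 - x)^p vanish
-- and (-1)^p = -1. Hence q ∏ (1 - q^m)^{2p} ≡ q E(q^p)^2 with E(q) = ∏ (1 - q^m), and by Euler's pentagonal
-- number theorem E(q^p) = Σ_j (-1)^j q^{p j(3j-1)/2}, whose square has the stated double sum as coefficient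
-- of q^n. Only finitely many coefficients matter, so all products are truncated; for those the pentagonal
-- number theorem follows from Shanks' finite identity
--   Σ_{k=0}^{m} (-1)^k q^{mk + k(k+1)/2} ∏_{j=k+1}^{m} (1 - q^j) = Σ_{|r| ≤ m} (-1)^r q^{r(3r-1)/2},
-- proved by induction on m.

module Submission where

open import Defs
open import Data.Nat using (ℕ; suc; _*_)
open import Data.Nat.Divisibility using () renaming (_∣_ to _∣ℕ_)
open import Data.Nat.Primality using (Prime)
open import Data.Integer using (+_; _-_)
open import Data.Integer.Divisibility using (_∣_)
open import Relation.Nullary using (¬_)

open import Data.Nat as ℕ using (zero; _+_; _∸_; _≤_; _<_; z≤n; s≤s; NonZero)
import Data.Nat.Properties as ℕₚ
open import Data.Nat.DivMod using (m*n/n≡m)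
open import Data.Integer.DivMod using (_/_)
open import Data.Integer as ℤ using (ℤ; -[1+_]; -_)
import Data.Integer.Properties as ℤₚ
open import Data.Integer.Divisibility.Signed as Signed using () renaming (_∣_ to _∣ˢ_)
open import Data.Nat.Divisibility using (divides; _∣0; ∣-refl; ∣m∣n⇒∣m+n; ∣⇒≤)
open import Data.Nat.Primality using (euclidsLemma; prime⇒nonZero)
open import Data.Nat.Combinatorics using (_C_; nCk+nC[k+1]≡[n+1]C[k+1]; nCn≡1; nC1≡n; k>n⇒nCk≡0)
open import Data.Sum using (inj₁; inj₂)
open import Data.Empty using (⊥-elim)
open import Data.Integer.Tactic.RingSolver using (solve-∀)
import Data.Nat.Tactic.RingSolver as ℕ-Ring
open import Data.List using (List; []; _∷_; map; _++_; applyUpTo; upTo; concatMap)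
open import Data.List.Properties using (map-∘; map-upTo)
open import Data.Bool using (true; false; if_then_else_)
open import Relation.Nullary using (yes; no; does)
open import Function using (_∘_)
open import Relation.Binary.PropositionalEquality
open ≡-Reasoning

shift : ℕ → Series → Series
shift zero    f n       = f n
shift (suc a) f zero    = + 0
shift (suc a) f (suc n) = shift a f n

shift-agree : ∀ a {f g n} → (∀ m → m ≤ n → f m ≡ g m) → shift a f n ≡ shift a g n
shift-agree zero    {n = n}     f≡g = f≡g n ℕₚ.≤-refl
shift-agree (suc a) {n = zero}  f≡g = refl
shift-agree (suc a) {n = suc n} f≡g = shift-agree a (λ m m≤n → f≡g m (ℕₚ.m≤n⇒m≤1+n m≤n))

shift-cong : ∀ a {f g} → f ≗ g → shift a f ≗ shift a g
shift-cong a f≗g n = shift-agree a (λ m _ → f≗g m)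

shift-map : ∀ a (h : ℤ → ℤ) {f} → h (+ 0) ≡ + 0 → shift a (h ∘ f) ≗ h ∘ shift a f
shift-map zero    h h0 n       = refl
shift-map (suc a) h h0 zero    = sym h0
shift-map (suc a) h h0 (suc n) = shift-map a h h0 n

shift-zipWith : ∀ a (_∙_ : ℤ → ℤ → ℤ) {f g} → (+ 0) ∙ (+ 0) ≡ + 0 →
                shift a (λ n → f n ∙ g n) ≗ λ n → shift a f n ∙ shift a g n
shift-zipWith zero    _∙_ h0 n       = refl
shift-zipWith (suc a) _∙_ h0 zero    = sym h0
shift-zipWith (suc a) _∙_ h0 (suc n) = shift-zipWith a _∙_ h0 n

shift-shift : ∀ a b f → shift a (shift b f) ≗ shift (a + b) f
shift-shift zero    b f n       = refl
shift-shift (suc a) b f zero    = refl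
shift-shift (suc a) b f (suc n) = shift-shift a b f n

shift-comm : ∀ a b f → shift a (shift b f) ≗ shift b (shift a f)
shift-comm a b f n = begin
  shift a (shift b f) n ≡⟨ shift-shift a b f n ⟩
  shift (a + b) f n     ≡⟨ cong (λ c → shift c f n) (ℕₚ.+-comm a b) ⟩
  shift (b + a) f n     ≡⟨ shift-shift b a f n ⟨
  shift b (shift a f) n ∎

shift-< : ∀ a f {n} → n < a → shift a f n ≡ + 0
shift-< (suc a) f {zero}  _         = refl
shift-< (suc a) f {suc n} (s≤s n<a) = shift-< a f n<a

shift-≥ : ∀ a f {n} → a ≤ n → shift a f n ≡ f (n ∸ a)
shift-≥ zero    f         _         = refl
shift-≥ (suc a) f {suc n} (s≤s a≤n) = shift-≥ a f a≤n

shift-All : ∀ (P : ℤ → Set) a {f} → P (+ 0) → (∀ n → P (f n)) → ∀ n → P (shift a f n)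
shift-All P zero    P0 Pf n       = Pf n
shift-All P (suc a) P0 Pf zero    = P0
shift-All P (suc a) P0 Pf (suc n) = shift-All P a P0 Pf n

shift-oneS : ∀ a n → shift a oneS n ≡ (if does (+ n ℤ.≟ + a) then + 1 else + 0)
shift-oneS zero    zero    = refl
shift-oneS zero    (suc n) = refl
shift-oneS (suc a) zero    = refl
shift-oneS (suc a) (suc n) = shift-oneS a n

[1-q^_] : ℕ → Series → Series
[1-q^ m ] f n = f n - shift m f n

mulFactor≗[1-q^] : ∀ m f → mulFactor m f ≗ [1-q^ m ] f
mulFactor≗[1-q^] m f n with m ℕₚ.≤? n
... | yes m≤n = cong (λ x → f n - x) (sym (shift-≥ m f m≤n))
... | no  m≰n = begin
  f n           ≡⟨ ℤₚ.+-identityʳ (f n) ⟨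
  f n - + 0     ≡⟨ cong (λ x → f n - x) (shift-< m f (ℕₚ.≰⇒> m≰n)) ⟨
  f n - shift m f n ∎

[1-q^]-cong : ∀ m {f g} → f ≗ g → [1-q^ m ] f ≗ [1-q^ m ] g
[1-q^]-cong m f≗g n = cong₂ _-_ (f≗g n) (shift-cong m f≗g n)

[1-q^]-comm : ∀ a b f → [1-q^ a ] ([1-q^ b ] f) ≗ [1-q^ b ] ([1-q^ a ] f)
[1-q^]-comm a b f n = begin
  (f n - shift b f n) - shift a (λ k → f k - shift b f k) n
    ≡⟨ cong (λ x → (f n - shift b f n) - x) (shift-zipWith a _-_ refl n) ⟩
  (f n - shift b f n) - (shift a f n - shift a (shift b f) n)
    ≡⟨ cong (λ x → (f n - shift b f n) - (shift a f n - x)) (shift-comm a b f n) ⟩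
  (f n - shift b f n) - (shift a f n - shift b (shift a f) n)
    ≡⟨ swap (f n) (shift b f n) (shift a f n) (shift b (shift a f) n) ⟩
  (f n - shift a f n) - (shift b f n - shift b (shift a f) n)
    ≡⟨ cong (λ x → (f n - shift a f n) - x) (shift-zipWith b _-_ refl n) ⟨
  (f n - shift a f n) - shift b (λ k → f k - shift a f k) n ∎
  where
  swap : ∀ w x y z → (w - x) - (y - z) ≡ (w - y) - (x - z)
  swap = solve-∀

factorsFrom : ℕ → ℕ → ℕ → Series → Series
factorsFrom d k zero    g = g
factorsFrom d k (suc l) g = [1-q^ d * (k + suc l) ] (factorsFrom d k l g)

eulerProduct : ℕ → ℕ → Series → Series
eulerProduct d = factorsFrom d 0

[1-q^]-factorsFrom : ∀ a d k l g → [1-q^ a ] (factorsFrom d k l g) ≗ factorsFrom d k l ([1-q^ a ] g)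
[1-q^]-factorsFrom a d k zero    g n = refl
[1-q^]-factorsFrom a d k (suc l) g n = begin
  [1-q^ a ] ([1-q^ d * (k + suc l) ] (factorsFrom d k l g)) n
    ≡⟨ [1-q^]-comm a (d * (k + suc l)) (factorsFrom d k l g) n ⟩
  [1-q^ d * (k + suc l) ] ([1-q^ a ] (factorsFrom d k l g)) n
    ≡⟨ [1-q^]-cong (d * (k + suc l)) ([1-q^]-factorsFrom a d k l g) n ⟩
  factorsFrom d k (suc l) ([1-q^ a ] g) n ∎

factorsFrom-lowest : ∀ d k l g → factorsFrom d k (suc l) g ≗ factorsFrom d (suc k) l ([1-q^ d * suc k ] g)
factorsFrom-lowest d k zero    g n = cong (λ j → [1-q^ d * j ] g n) (ℕₚ.+-comm k 1)
factorsFrom-lowest d k (suc l) g n = begin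
  [1-q^ d * (k + suc (suc l)) ] (factorsFrom d k (suc l) g) n
    ≡⟨ [1-q^]-cong (d * (k + suc (suc l))) (factorsFrom-lowest d k l g) n ⟩
  [1-q^ d * (k + suc (suc l)) ] (factorsFrom d (suc k) l ([1-q^ d * suc k ] g)) n
    ≡⟨ cong (λ j → [1-q^ d * j ] (factorsFrom d (suc k) l ([1-q^ d * suc k ] g)) n) (ℕₚ.+-suc k (suc l)) ⟩
  factorsFrom d (suc k) (suc l) ([1-q^ d * suc k ] g) n ∎

infixl 10 ∑<

∑< : ℕ → (ℕ → ℤ) → ℤ
∑< zero    f = + 0
∑< (suc n) f = ∑< n f ℤ.+ f n

syntax ∑< n (λ k → e) = ∑[ k < n ] e

∑-cong : ∀ n {f g : ℕ → ℤ} → (∀ k → k < n → f k ≡ g k) → ∑[ k < n ] f k ≡ ∑[ k < n ] g k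
∑-cong zero    f≡g = refl
∑-cong (suc n) f≡g = cong₂ ℤ._+_ (∑-cong n (λ k k<n → f≡g k (ℕₚ.m<n⇒m<1+n k<n))) (f≡g n ℕₚ.≤-refl)

∑-zero : ∀ n {f : ℕ → ℤ} → (∀ k → f k ≡ + 0) → ∑[ k < n ] f k ≡ + 0
∑-zero zero    f≡0 = refl
∑-zero (suc n) f≡0 = cong₂ ℤ._+_ (∑-zero n f≡0) (f≡0 n)

∑-first : ∀ n (f : ℕ → ℤ) → ∑[ k < suc n ] f k ≡ f 0 ℤ.+ ∑[ k < n ] f (suc k)
∑-first zero    f = ℤₚ.+-comm (+ 0) (f 0)
∑-first (suc n) f = begin
  ∑[ k < suc n ] f k ℤ.+ f (suc n)                 ≡⟨ cong (ℤ._+ f (suc n)) (∑-first n f) ⟩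
  (f 0 ℤ.+ ∑[ k < n ] f (suc k)) ℤ.+ f (suc n)     ≡⟨ ℤₚ.+-assoc (f 0) _ _ ⟩
  f 0 ℤ.+ ∑[ k < suc n ] f (suc k)                 ∎

∑-- : ∀ n (f g : ℕ → ℤ) → ∑[ k < n ] (f k - g k) ≡ ∑[ k < n ] f k - ∑[ k < n ] g k
∑-- zero    f g = refl
∑-- (suc n) f g = begin
  ∑[ k < n ] (f k - g k) ℤ.+ (f n - g n)
    ≡⟨ cong (ℤ._+ (f n - g n)) (∑-- n f g) ⟩
  (∑[ k < n ] f k - ∑[ k < n ] g k) ℤ.+ (f n - g n)
    ≡⟨ interchange (∑[ k < n ] f k) (∑[ k < n ] g k) (f n) (g n) ⟩
  ∑[ k < suc n ] f k - ∑[ k < suc n ] g k ∎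
  where
  interchange : ∀ a b x y → (a - b) ℤ.+ (x - y) ≡ (a ℤ.+ x) - (b ℤ.+ y)
  interchange = solve-∀

∑-telescope : ∀ n (f : ℕ → ℤ) → ∑[ k < n ] (f (suc k) - f k) ≡ f n - f 0
∑-telescope zero    f = sym (ℤₚ.+-inverseʳ (f 0))
∑-telescope (suc n) f = begin
  ∑[ k < n ] (f (suc k) - f k) ℤ.+ (f (suc n) - f n) ≡⟨ cong (ℤ._+ (f (suc n) - f n)) (∑-telescope n f) ⟩
  (f n - f 0) ℤ.+ (f (suc n) - f n)                   ≡⟨ cancel (f n) (f 0) (f (suc n)) ⟩
  f (suc n) - f 0                                     ∎
  where
  cancel : ∀ x y z → (x - y) ℤ.+ (z - x) ≡ z - y
  cancel = solve-∀

shift-∑ : ∀ a n (F : ℕ → Series) x → shift a (λ y → ∑[ k < n ] F k y) x ≡ ∑[ k < n ] shift a (F k) x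
shift-∑ a zero    F x = shift-map a (λ _ → + 0) {f = λ _ → + 0} refl x
shift-∑ a (suc n) F x =
  trans (shift-zipWith a ℤ._+_ refl x) (cong (ℤ._+ shift a (F n) x) (shift-∑ a n F x))

∑± : ℕ → (ℤ → ℤ) → ℤ
∑± zero    F = F (+ 0)
∑± (suc n) F = ∑± n F ℤ.+ (F (+ suc n) ℤ.+ F -[1+ n ])

∑±-cong : ∀ n {F G : ℤ → ℤ} → (∀ r → F r ≡ G r) → ∑± n F ≡ ∑± n G
∑±-cong zero    F≡G = F≡G (+ 0)
∑±-cong (suc n) F≡G = cong₂ ℤ._+_ (∑±-cong n F≡G) (cong₂ ℤ._+_ (F≡G _) (F≡G _))

∑±-*-distribˡ : ∀ n a F → a ℤ.* ∑± n F ≡ ∑± n (λ r → a ℤ.* F r)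
∑±-*-distribˡ zero    a F = refl
∑±-*-distribˡ (suc n) a F = begin
  a ℤ.* (∑± n F ℤ.+ (F (+ suc n) ℤ.+ F -[1+ n ]))
    ≡⟨ distrib a (∑± n F) _ _ ⟩
  a ℤ.* ∑± n F ℤ.+ (a ℤ.* F (+ suc n) ℤ.+ a ℤ.* F -[1+ n ])
    ≡⟨ cong (ℤ._+ (a ℤ.* F (+ suc n) ℤ.+ a ℤ.* F -[1+ n ])) (∑±-*-distribˡ n a F) ⟩
  ∑± (suc n) (λ r → a ℤ.* F r) ∎
  where
  distrib : ∀ a s x y → a ℤ.* (s ℤ.+ (x ℤ.+ y)) ≡ a ℤ.* s ℤ.+ (a ℤ.* x ℤ.+ a ℤ.* y)
  distrib = solve-∀

shift-∑± : ∀ a n (F : ℤ → Series) x → shift a (λ y → ∑± n (λ r → F r y)) x ≡ ∑± n (λ r → shift a (F r) x)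
shift-∑± a zero    F x = refl
shift-∑± a (suc n) F x = begin
  shift a (λ y → ∑± n (λ r → F r y) ℤ.+ (F (+ suc n) y ℤ.+ F -[1+ n ] y)) x
    ≡⟨ shift-zipWith a ℤ._+_ refl x ⟩
  shift a (λ y → ∑± n (λ r → F r y)) x ℤ.+ shift a (λ y → F (+ suc n) y ℤ.+ F -[1+ n ] y) x
    ≡⟨ cong₂ ℤ._+_ (shift-∑± a n F x) (shift-zipWith a ℤ._+_ refl x) ⟩
  ∑± (suc n) (λ r → shift a (F r) x) ∎

triangle : ℕ → ℕ
triangle zero    = 0
triangle (suc k) = triangle k + suc k

-- j(3j-1)/2, computed in ℕ
pentℕ : ℤ → ℕ
pentℕ (+ zero)   = 0
pentℕ (+ suc k)  = suc k * suc k + triangle k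
pentℕ -[1+ k ]   = suc k * suc k + triangle (suc k)

triangle-double : ∀ k → triangle k * 2 ≡ k * suc k
triangle-double zero    = refl
triangle-double (suc k) = begin
  (triangle k + suc k) * 2   ≡⟨ ℕₚ.*-distribʳ-+ 2 (triangle k) (suc k) ⟩
  triangle k * 2 + suc k * 2 ≡⟨ cong (_+ suc k * 2) (triangle-double k) ⟩
  k * suc k + suc k * 2      ≡⟨ ℕ-lemma k ⟩
  suc k * suc (suc k)        ∎
  where
  ℕ-lemma : ∀ k → k * suc k + suc k * 2 ≡ suc k * suc (suc k)
  ℕ-lemma = ℕ-Ring.solve-∀

pos-[a*a+t]*2 : ∀ a t {b} → t * 2 ≡ b → + ((a * a + t) * 2) ≡ + a ℤ.* + a ℤ.* + 2 ℤ.+ + b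
pos-[a*a+t]*2 a t {b} t*2≡b = begin
  + ((a * a + t) * 2)         ≡⟨ cong +_ (ℕₚ.*-distribʳ-+ 2 (a * a) t) ⟩
  + (a * a * 2 + t * 2)       ≡⟨ cong (λ c → + (a * a * 2 + c)) t*2≡b ⟩
  + (a * a * 2) ℤ.+ + b       ≡⟨ cong (ℤ._+ + b) (trans (ℤₚ.pos-* (a * a) 2) (cong (ℤ._* + 2) (ℤₚ.pos-* a a))) ⟩
  + a ℤ.* + a ℤ.* + 2 ℤ.+ + b ∎

pentℕ*2 : ∀ r → + (pentℕ r * 2) ≡ r ℤ.* (+ 3 ℤ.* r - + 1)
pentℕ*2 (+ zero)  = refl
pentℕ*2 (+ suc k) = begin
  + ((suc k * suc k + triangle k) * 2)
    ≡⟨ pos-[a*a+t]*2 (suc k) (triangle k) (triangle-double k) ⟩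
  + suc k ℤ.* + suc k ℤ.* + 2 ℤ.+ + (k * suc k)
    ≡⟨ cong (ℤ._+_ (+ suc k ℤ.* + suc k ℤ.* + 2)) (ℤₚ.pos-* k (suc k)) ⟩
  (+ 1 ℤ.+ + k) ℤ.* (+ 1 ℤ.+ + k) ℤ.* + 2 ℤ.+ + k ℤ.* (+ 1 ℤ.+ + k)
    ≡⟨ ring (+ k) ⟩
  + suc k ℤ.* (+ 3 ℤ.* + suc k - + 1) ∎
  where
  ring : ∀ x → (+ 1 ℤ.+ x) ℤ.* (+ 1 ℤ.+ x) ℤ.* + 2 ℤ.+ x ℤ.* (+ 1 ℤ.+ x)
             ≡ (+ 1 ℤ.+ x) ℤ.* (+ 3 ℤ.* (+ 1 ℤ.+ x) - + 1)
  ring = solve-∀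
pentℕ*2 -[1+ k ]  = begin
  + ((suc k * suc k + triangle (suc k)) * 2)
    ≡⟨ pos-[a*a+t]*2 (suc k) (triangle (suc k)) (triangle-double (suc k)) ⟩
  + suc k ℤ.* + suc k ℤ.* + 2 ℤ.+ + (suc k * suc (suc k))
    ≡⟨ cong (ℤ._+_ (+ suc k ℤ.* + suc k ℤ.* + 2)) (ℤₚ.pos-* (suc k) (suc (suc k))) ⟩
  (+ 1 ℤ.+ + k) ℤ.* (+ 1 ℤ.+ + k) ℤ.* + 2 ℤ.+ (+ 1 ℤ.+ + k) ℤ.* (+ 2 ℤ.+ + k)
    ≡⟨ ring (+ k) ⟩
  -[1+ k ] ℤ.* (+ 3 ℤ.* -[1+ k ] - + 1) ∎
  where
  ring : ∀ x → (+ 1 ℤ.+ x) ℤ.* (+ 1 ℤ.+ x) ℤ.* + 2 ℤ.+ (+ 1 ℤ.+ x) ℤ.* (+ 2 ℤ.+ x)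
             ≡ (- (+ 1 ℤ.+ x)) ℤ.* (+ 3 ℤ.* (- (+ 1 ℤ.+ x)) - + 1)
  ring = solve-∀

pent≡pentℕ : ∀ r → pent r ≡ + pentℕ r
pent≡pentℕ r = begin
  r ℤ.* (+ 3 ℤ.* r - + 1) / + 2 ≡⟨ cong (_/ + 2) (pentℕ*2 r) ⟨
  + (pentℕ r * 2) / + 2         ≡⟨ ℤₚ.*-identityˡ _ ⟩
  + (pentℕ r * 2 ℕ./ 2)         ≡⟨ cong +_ (m*n/n≡m (pentℕ r) 2) ⟩
  + pentℕ r                     ∎

module Shanks (d : ℕ) (g : Series) where

  shift-d* : ∀ a b f → shift (d * a) (shift (d * b) f) ≗ shift (d * (a + b)) f
  shift-d* a b f n = trans (shift-shift (d * a) (d * b) f n)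
                           (cong (λ e → shift e f n) (sym (ℕₚ.*-distribˡ-+ d a b)))

  U : ℕ → ℕ → Series
  U m k = factorsFrom d k (m ∸ k) g

  U-suc : ∀ {m k} → k ≤ m → U (suc m) k ≗ [1-q^ d * suc m ] (U m k)
  U-suc {m} {k} k≤m n = begin
    factorsFrom d k (suc m ∸ k) g n
      ≡⟨ cong (λ l → factorsFrom d k l g n) (ℕₚ.+-∸-assoc 1 k≤m) ⟩
    [1-q^ d * (k + suc (m ∸ k)) ] (U m k) n
      ≡⟨ cong (λ j → [1-q^ d * j ] (U m k) n) (trans (ℕₚ.+-suc k (m ∸ k)) (cong suc (ℕₚ.m+[n∸m]≡n k≤m))) ⟩
    [1-q^ d * suc m ] (U m k) n ∎

  U-lowest : ∀ {m i} → i < m → U m i ≗ [1-q^ d * suc i ] (U m (suc i))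
  U-lowest {m} {i} i<m n = begin
    factorsFrom d i (m ∸ i) g n
      ≡⟨ cong (λ l → factorsFrom d i l g n) (ℕₚ.+-∸-assoc 1 i<m) ⟩
    factorsFrom d i (suc (m ∸ suc i)) g n
      ≡⟨ factorsFrom-lowest d i (m ∸ suc i) g n ⟩
    factorsFrom d (suc i) (m ∸ suc i) ([1-q^ d * suc i ] g) n
      ≡⟨ [1-q^]-factorsFrom (d * suc i) d (suc i) (m ∸ suc i) g n ⟨
    [1-q^ d * suc i ] (U m (suc i)) n ∎

  U-diag : ∀ m → U m m ≗ g
  U-diag m n = cong (λ l → factorsFrom d m l g n) (ℕₚ.n∸n≡0 m)

  S : ℕ → Series
  S m x = ∑[ k < suc m ] (negOnePowℕ k ℤ.* shift (d * (m * k + triangle k)) (U m k) x)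

  P : ℕ → Series
  P m x = ∑± m (λ r → negOnePow r ℤ.* shift (d * pentℕ r) g x)

  -- For k ≤ m the summand B k of S (m+1) equals A k - (C k - C (k-1)), A k being the summand of S m; the
  -- corrections telescope to C m, which with the last summand B (m+1) gives the two new pentagonal terms.
  module Step (m x : ℕ) where

    A B C X : ℕ → ℤ
    A k = negOnePowℕ k ℤ.* shift (d * (m * k + triangle k)) (U m k) x
    B k = negOnePowℕ k ℤ.* shift (d * (suc m * k + triangle k)) (U (suc m) k) x
    C k = negOnePowℕ k ℤ.* shift (d * (suc m * suc k + triangle k)) (U m k) x
    X k = negOnePowℕ k ℤ.* shift (d * ((m * k + triangle k) + k)) (U m k) x

    C⁻ : ℕ → ℤ
    C⁻ zero    = + 0
    C⁻ (suc k) = C k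

    B≡X-C : ∀ {k} → k ≤ m → B k ≡ X k - C k
    B≡X-C {k} k≤m = begin
      s ℤ.* shift (d * E) (U (suc m) k) x
        ≡⟨ cong (s ℤ.*_) (shift-cong (d * E) (U-suc k≤m) x) ⟩
      s ℤ.* shift (d * E) (λ y → U m k y - shift (d * suc m) (U m k) y) x
        ≡⟨ cong (s ℤ.*_) (shift-zipWith (d * E) _-_ refl x) ⟩
      s ℤ.* (shift (d * E) (U m k) x - shift (d * E) (shift (d * suc m) (U m k)) x)
        ≡⟨ cong₂ (λ a b → s ℤ.* (shift a (U m k) x - b))
                 (cong (d *_) (ℕ-lemma₁ m k (triangle k)))
                 (trans (shift-d* E (suc m) (U m k) x)
                        (cong (λ e → shift (d * e) (U m k) x) (ℕ-lemma₂ m k (triangle k)))) ⟩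
      s ℤ.* (shift (d * ((m * k + triangle k) + k)) (U m k) x - shift (d * (suc m * suc k + triangle k)) (U m k) x)
        ≡⟨ distrib s _ _ ⟩
      X k - C k ∎
      where
      s = negOnePowℕ k
      E = suc m * k + triangle k
      ℕ-lemma₁ : ∀ m k t → suc m * k + t ≡ (m * k + t) + k
      ℕ-lemma₁ = ℕ-Ring.solve-∀
      ℕ-lemma₂ : ∀ m k t → (suc m * k + t) + suc m ≡ suc m * suc k + t
      ℕ-lemma₂ = ℕ-Ring.solve-∀
      distrib : ∀ s a b → s ℤ.* (a - b) ≡ s ℤ.* a - s ℤ.* b
      distrib = solve-∀

    X≡A+C⁻ : ∀ {k} → k ≤ m → X k ≡ A k ℤ.+ C⁻ k
    X≡A+C⁻ {zero}  _      = begin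
      + 1 ℤ.* shift (d * ((m * 0 + 0) + 0)) (U m 0) x
        ≡⟨ cong (λ e → + 1 ℤ.* shift (d * e) (U m 0) x) (ℕₚ.+-identityʳ (m * 0 + 0)) ⟩
      A 0               ≡⟨ ℤₚ.+-identityʳ (A 0) ⟨
      A 0 ℤ.+ + 0       ∎
    X≡A+C⁻ {suc i} i<m = begin
      - s ℤ.* shift (d * (E + suc i)) (U m (suc i)) x
        ≡⟨ regroup s (shift (d * E) (U m (suc i)) x) _ ⟩
      - s ℤ.* shift (d * E) (U m (suc i)) x
        ℤ.+ s ℤ.* (shift (d * E) (U m (suc i)) x - shift (d * (E + suc i)) (U m (suc i)) x)
        ≡⟨ cong (λ c → A (suc i) ℤ.+ s ℤ.* c) lowest ⟩
      A (suc i) ℤ.+ s ℤ.* shift (d * E) (U m i) x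
        ≡⟨ cong (λ e → A (suc i) ℤ.+ s ℤ.* shift (d * e) (U m i) x) (ℕ-lemma m i (triangle i)) ⟩
      A (suc i) ℤ.+ C i ∎
      where
      s = negOnePowℕ i
      E = m * suc i + triangle (suc i)
      regroup : ∀ s a b → - s ℤ.* b ≡ - s ℤ.* a ℤ.+ s ℤ.* (a - b)
      regroup = solve-∀
      ℕ-lemma : ∀ m i t → m * suc i + (t + suc i) ≡ suc m * suc i + t
      ℕ-lemma = ℕ-Ring.solve-∀
      lowest : shift (d * E) (U m (suc i)) x - shift (d * (E + suc i)) (U m (suc i)) x
             ≡ shift (d * E) (U m i) x
      lowest = sym (begin
        shift (d * E) (U m i) x
          ≡⟨ shift-cong (d * E) (U-lowest i<m) x ⟩
        shift (d * E) (λ y → U m (suc i) y - shift (d * suc i) (U m (suc i)) y) x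
          ≡⟨ shift-zipWith (d * E) _-_ refl x ⟩
        shift (d * E) (U m (suc i)) x - shift (d * E) (shift (d * suc i) (U m (suc i))) x
          ≡⟨ cong (λ c → shift (d * E) (U m (suc i)) x - c) (shift-d* E (suc i) (U m (suc i)) x) ⟩
        shift (d * E) (U m (suc i)) x - shift (d * (E + suc i)) (U m (suc i)) x ∎)

    B≡A-ΔC⁻ : ∀ {k} → k ≤ m → B k ≡ A k - (C⁻ (suc k) - C⁻ k)
    B≡A-ΔC⁻ {k} k≤m = begin
      B k                           ≡⟨ B≡X-C k≤m ⟩
      X k - C k                     ≡⟨ cong (_- C k) (X≡A+C⁻ k≤m) ⟩
      (A k ℤ.+ C⁻ k) - C k          ≡⟨ rearrange (A k) (C⁻ k) (C k) ⟩
      A k - (C k - C⁻ k)            ∎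
      where
      rearrange : ∀ a c⁻ c → (a ℤ.+ c⁻) - c ≡ a - (c - c⁻)
      rearrange = solve-∀

    step : S (suc m) x ≡ S m x ℤ.+ (negOnePowℕ (suc m) ℤ.* shift (d * pentℕ (+ suc m)) g x
                                    ℤ.+ negOnePowℕ (suc m) ℤ.* shift (d * pentℕ -[1+ m ]) g x)
    step = begin
      ∑[ k < suc m ] B k ℤ.+ B (suc m)
        ≡⟨ cong (ℤ._+ B (suc m)) (∑-cong (suc m) (λ k k<1+m → B≡A-ΔC⁻ (ℕₚ.≤-pred k<1+m))) ⟩
      ∑[ k < suc m ] (A k - (C⁻ (suc k) - C⁻ k)) ℤ.+ B (suc m)
        ≡⟨ cong (ℤ._+ B (suc m)) (∑-- (suc m) A (λ k → C⁻ (suc k) - C⁻ k)) ⟩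
      (S m x - ∑[ k < suc m ] (C⁻ (suc k) - C⁻ k)) ℤ.+ B (suc m)
        ≡⟨ cong (λ c → (S m x - c) ℤ.+ B (suc m)) (∑-telescope (suc m) C⁻) ⟩
      (S m x - (C m - + 0)) ℤ.+ B (suc m)
        ≡⟨ cong₂ (λ a b → (S m x - (negOnePowℕ m ℤ.* a - + 0)) ℤ.+ negOnePowℕ (suc m) ℤ.* b)
                 (shift-cong (d * pentℕ (+ suc m)) (U-diag m) x)
                 (shift-cong (d * pentℕ -[1+ m ]) (U-diag (suc m)) x) ⟩
      (S m x - (negOnePowℕ m ℤ.* a - + 0)) ℤ.+ - negOnePowℕ m ℤ.* b
        ≡⟨ collect (S m x) (negOnePowℕ m) a b ⟩
      S m x ℤ.+ (- negOnePowℕ m ℤ.* a ℤ.+ - negOnePowℕ m ℤ.* b) ∎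
      where
      a = shift (d * pentℕ (+ suc m)) g x
      b = shift (d * pentℕ -[1+ m ]) g x
      collect : ∀ t s a b → (t - (s ℤ.* a - + 0)) ℤ.+ - s ℤ.* b ≡ t ℤ.+ (- s ℤ.* a ℤ.+ - s ℤ.* b)
      collect = solve-∀

  shanks : ∀ m → S m ≗ P m
  shanks zero    x = ℤₚ.+-identityˡ _
  shanks (suc m) x = trans (Step.step m x) (cong (ℤ._+ (t (+ suc m) ℤ.+ t -[1+ m ])) (shanks m x))
    where
    t : ℤ → ℤ
    t r = negOnePow r ℤ.* shift (d * pentℕ r) g x

  S-truncation : .{{_ : NonZero d}} → ∀ {N M} → M ≤ N → S N M ≡ eulerProduct d N g M
  S-truncation {N} {M} M≤N = begin
    S N M
      ≡⟨ ∑-first N A ⟩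
    A 0 ℤ.+ ∑[ k < N ] A (suc k)
      ≡⟨ cong (ℤ._+_ (A 0)) (∑-zero N (λ k → vanish k)) ⟩
    A 0 ℤ.+ + 0
      ≡⟨ ℤₚ.+-identityʳ (A 0) ⟩
    + 1 ℤ.* shift (d * (N * 0 + 0)) (U N 0) M
      ≡⟨ cong (λ e → + 1 ℤ.* shift e (U N 0) M) exponent-zero ⟩
    + 1 ℤ.* eulerProduct d N g M
      ≡⟨ ℤₚ.*-identityˡ _ ⟩
    eulerProduct d N g M ∎
    where
    A : ℕ → ℤ
    A k = negOnePowℕ k ℤ.* shift (d * (N * k + triangle k)) (U N k) M
    exponent-zero : d * (N * 0 + 0) ≡ 0
    exponent-zero = trans (cong (d *_) (trans (ℕₚ.+-identityʳ (N * 0)) (ℕₚ.*-zeroʳ N))) (ℕₚ.*-zeroʳ d)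
    exponent-large : ∀ k → M < d * (N * suc k + triangle (suc k))
    exponent-large k =
      ℕₚ.<-≤-trans (ℕₚ.≤-<-trans (ℕₚ.≤-trans M≤N (ℕₚ.m≤m*n N (suc k))) (ℕₚ.m<m+n (N * suc k) 0<T))
                   (ℕₚ.m≤n*m _ d)
      where
      0<T : 0 < triangle (suc k)
      0<T = ℕₚ.<-≤-trans (s≤s z≤n) (ℕₚ.m≤n+m (suc k) (triangle k))
    vanish : ∀ k → A (suc k) ≡ + 0
    vanish k = trans (cong (negOnePowℕ (suc k) ℤ.*_) (shift-< _ (U N (suc k)) (exponent-large k)))
                     (ℤₚ.*-zeroʳ (negOnePowℕ (suc k)))

pentagonal : ∀ d .{{_ : NonZero d}} g {N M} → M ≤ N →
             eulerProduct d N g M ≡ ∑± N (λ r → negOnePow r ℤ.* shift (d * pentℕ r) g M)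
pentagonal d g {N} {M} M≤N = trans (sym (S-truncation M≤N)) (shanks N M)
  where open Shanks d g

[1+k]*[1+n]C[1+k]≡[1+n]*nCk : ∀ n k → suc k * (suc n C suc k) ≡ suc n * (n C k)
[1+k]*[1+n]C[1+k]≡[1+n]*nCk zero    zero    = refl
[1+k]*[1+n]C[1+k]≡[1+n]*nCk zero    (suc k) = ℕₚ.*-zeroʳ (suc (suc k))
[1+k]*[1+n]C[1+k]≡[1+n]*nCk (suc n) zero    = trans (ℕₚ.+-identityʳ _) (trans (nC1≡n (suc (suc n))) (sym (ℕₚ.*-identityʳ _)))
[1+k]*[1+n]C[1+k]≡[1+n]*nCk (suc n) (suc k) = begin
  suc (suc k) * (suc (suc n) C suc (suc k))
    ≡⟨ cong (suc (suc k) *_) (nCk+nC[k+1]≡[n+1]C[k+1] (suc n) (suc k)) ⟨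
  suc (suc k) * (suc n C suc k + suc n C suc (suc k))
    ≡⟨ ℕ-lemma₁ k (suc n C suc k) (suc n C suc (suc k)) ⟩
  suc n C suc k + suc k * (suc n C suc k) + suc (suc k) * (suc n C suc (suc k))
    ≡⟨ cong₂ (λ u v → suc n C suc k + u + v) ([1+k]*[1+n]C[1+k]≡[1+n]*nCk n k) ([1+k]*[1+n]C[1+k]≡[1+n]*nCk n (suc k)) ⟩
  suc n C suc k + suc n * (n C k) + suc n * (n C suc k)
    ≡⟨ cong (λ c → c + suc n * (n C k) + suc n * (n C suc k)) (nCk+nC[k+1]≡[n+1]C[k+1] n k) ⟨
  (n C k + n C suc k) + suc n * (n C k) + suc n * (n C suc k)
    ≡⟨ ℕ-lemma₂ n (n C k) (n C suc k) ⟩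
  suc (suc n) * (n C k + n C suc k)
    ≡⟨ cong (suc (suc n) *_) (nCk+nC[k+1]≡[n+1]C[k+1] n k) ⟩
  suc (suc n) * (suc n C suc k) ∎
  where
  ℕ-lemma₁ : ∀ k a b → suc (suc k) * (a + b) ≡ a + suc k * a + suc (suc k) * b
  ℕ-lemma₁ = ℕ-Ring.solve-∀
  ℕ-lemma₂ : ∀ n a b → (a + b) + suc n * a + suc n * b ≡ suc (suc n) * (a + b)
  ℕ-lemma₂ = ℕ-Ring.solve-∀

prime⇒p∣pCj : ∀ {p j} → Prime p → 0 < j → j < p → p ∣ℕ p C j
prime⇒p∣pCj {suc q} {suc i} p-prime _ j<p with euclidsLemma (suc i) (suc q C suc i) p-prime p∣j*C
  where
  p∣j*C : suc q ∣ℕ suc i * (suc q C suc i)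
  p∣j*C = divides (q C i) (trans ([1+k]*[1+n]C[1+k]≡[1+n]*nCk q i) (ℕₚ.*-comm (suc q) (q C i)))
... | inj₁ p∣j = ⊥-elim (ℕₚ.<⇒≱ j<p (∣⇒≤ p∣j))
... | inj₂ p∣C = p∣C

negOnePowℕ-odd : ∀ n → ¬ 2 ∣ℕ n → negOnePowℕ n ≡ - + 1
negOnePowℕ-odd zero          ¬2∣0   = ⊥-elim (¬2∣0 (2 ∣0))
negOnePowℕ-odd (suc zero)    _      = refl
negOnePowℕ-odd (suc (suc n)) ¬2∣2+n = trans (ℤₚ.neg-involutive (negOnePowℕ n))
                                           (negOnePowℕ-odd n (¬2∣2+n ∘ ∣m∣n⇒∣m+n ∣-refl))

binomialTerm : ℕ → ℕ → Series → ℕ → Series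
binomialTerm m k f j x = negOnePowℕ j ℤ.* + (k C j) ℤ.* shift (j * m) f x

binomialTerm-beyond : ∀ m k f x → binomialTerm m k f (suc k) x ≡ + 0
binomialTerm-beyond m k f x = begin
  negOnePowℕ (suc k) ℤ.* + (k C suc k) ℤ.* shift (suc k * m) f x
    ≡⟨ cong (λ c → negOnePowℕ (suc k) ℤ.* + c ℤ.* shift (suc k * m) f x) (k>n⇒nCk≡0 (ℕₚ.n<1+n k)) ⟩
  negOnePowℕ (suc k) ℤ.* + 0 ℤ.* shift (suc k * m) f x
    ≡⟨ cong (ℤ._* shift (suc k * m) f x) (ℤₚ.*-zeroʳ (negOnePowℕ (suc k))) ⟩
  + 0 ∎

binomialTerm-pascal : ∀ m k f j x →
  binomialTerm m (suc k) f (suc j) x ≡ binomialTerm m k f (suc j) x - shift m (binomialTerm m k f j) x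
binomialTerm-pascal m k f j x = begin
  - s ℤ.* + (suc k C suc j) ℤ.* a
    ≡⟨ cong (λ c → - s ℤ.* + c ℤ.* a) (nCk+nC[k+1]≡[n+1]C[k+1] k j) ⟨
  - s ℤ.* (+ (k C j) ℤ.+ + (k C suc j)) ℤ.* a
    ≡⟨ split s (+ (k C j)) (+ (k C suc j)) a ⟩
  - s ℤ.* + (k C suc j) ℤ.* a - s ℤ.* + (k C j) ℤ.* a
    ≡⟨ cong (λ c → - s ℤ.* + (k C suc j) ℤ.* a - c) shifted ⟨
  binomialTerm m k f (suc j) x - shift m (binomialTerm m k f j) x ∎
  where
  s = negOnePowℕ j
  a = shift (suc j * m) f x
  split : ∀ s c c' a → - s ℤ.* (c ℤ.+ c') ℤ.* a ≡ - s ℤ.* c' ℤ.* a - s ℤ.* c ℤ.* a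
  split = solve-∀
  shifted : shift m (binomialTerm m k f j) x ≡ s ℤ.* + (k C j) ℤ.* a
  shifted = trans (shift-map m (s ℤ.* + (k C j) ℤ.*_) (ℤₚ.*-zeroʳ (s ℤ.* + (k C j))) x)
                  (cong (s ℤ.* + (k C j) ℤ.*_) (shift-shift m (j * m) f x))

powFactor-binomial : ∀ m k f x → powFactor m k f x ≡ ∑[ j < suc k ] binomialTerm m k f j x
powFactor-binomial m zero    f x = sym (trans (ℤₚ.+-identityˡ _) (ℤₚ.*-identityˡ (f x)))
powFactor-binomial m (suc k) f x = begin
  mulFactor m F x
    ≡⟨ mulFactor≗[1-q^] m F x ⟩
  F x - shift m F x
    ≡⟨ cong₂ _-_ (powFactor-binomial m k f x)
                 (trans (shift-cong m (powFactor-binomial m k f) x) (shift-∑ m (suc k) t x)) ⟩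
  ∑[ j < suc k ] t j x - ∑[ j < suc k ] u j
    ≡⟨ cong (_- ∑[ j < suc k ] u j) (ℤₚ.+-identityʳ (∑[ j < suc k ] t j x)) ⟨
  ∑[ j < suc k ] t j x ℤ.+ + 0 - ∑[ j < suc k ] u j
    ≡⟨ cong (λ c → ∑[ j < suc k ] t j x ℤ.+ c - ∑[ j < suc k ] u j) (binomialTerm-beyond m k f x) ⟨
  ∑[ j < suc (suc k) ] t j x - ∑[ j < suc k ] u j
    ≡⟨ cong (_- ∑[ j < suc k ] u j) (∑-first (suc k) (λ j → t j x)) ⟩
  t 0 x ℤ.+ ∑[ j < suc k ] t (suc j) x - ∑[ j < suc k ] u j
    ≡⟨ ℤₚ.+-assoc (t 0 x) _ _ ⟩
  t 0 x ℤ.+ (∑[ j < suc k ] t (suc j) x - ∑[ j < suc k ] u j)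
    ≡⟨ cong (ℤ._+_ (t 0 x)) (∑-- (suc k) (λ j → t (suc j) x) u) ⟨
  t 0 x ℤ.+ ∑[ j < suc k ] (t (suc j) x - u j)
    ≡⟨ cong (ℤ._+_ (t 0 x)) (∑-cong (suc k) (λ j _ → sym (binomialTerm-pascal m k f j x))) ⟩
  binomialTerm m (suc k) f 0 x ℤ.+ ∑[ j < suc k ] binomialTerm m (suc k) f (suc j) x
    ≡⟨ ∑-first (suc k) (λ j → binomialTerm m (suc k) f j x) ⟨
  ∑[ j < suc (suc k) ] binomialTerm m (suc k) f j x ∎
  where
  F = powFactor m k f
  t = binomialTerm m k f
  u : ℕ → ℤ
  u j = shift m (t j) x

infix 4 _≈_mod_
record _≈_mod_ (f g : Series) (p : ℕ) : Set where
  constructor congruent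
  field
    ∣-difference : ∀ n → + p ∣ˢ f n - g n

∣ˢ0 : ∀ {k} → k ∣ˢ + 0
∣ˢ0 {k} = Signed.divides (+ 0) (sym (ℤₚ.*-zeroˡ k))

≗⇒≈ : ∀ {p f g} → f ≗ g → f ≈ g mod p
≗⇒≈ {f = f} f≗g = congruent λ n →
  subst (_ ∣ˢ_) (trans (sym (ℤₚ.+-inverseʳ (f n))) (cong (λ c → f n - c) (f≗g n))) ∣ˢ0

≈-trans : ∀ {p f g h} → f ≈ g mod p → g ≈ h mod p → f ≈ h mod p
≈-trans {f = f} {g} {h} (congruent f≈g) (congruent g≈h) = congruent λ n →
  subst (_ ∣ˢ_) (cancel (f n) (g n) (h n)) (Signed.∣m∣n⇒∣m+n (f≈g n) (g≈h n))
  where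
  cancel : ∀ a b c → (a - b) ℤ.+ (b - c) ≡ a - c
  cancel = solve-∀

[1-q^]-≈ : ∀ {p f g} m → f ≈ g mod p → [1-q^ m ] f ≈ [1-q^ m ] g mod p
[1-q^]-≈ {p} {f} {g} m (congruent f≈g) = congruent λ n → subst (_ ∣ˢ_) (difference n)
  (Signed.∣m∣n⇒∣m-n (f≈g n) (shift-All (+ p ∣ˢ_) m ∣ˢ0 f≈g n))
  where
  interchange : ∀ a b c d → (a - b) - (c - d) ≡ (a - c) - (b - d)
  interchange = solve-∀
  difference : ∀ n → (f n - g n) - shift m (λ k → f k - g k) n ≡ [1-q^ m ] f n - [1-q^ m ] g n
  difference n = trans (cong (λ c → (f n - g n) - c) (shift-zipWith m _-_ refl n))
                       (interchange (f n) (g n) (shift m f n) (shift m g n))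

∑-∣ˢ : ∀ {k} n (f : ℕ → ℤ) → (∀ j → j < n → k ∣ˢ f j) → k ∣ˢ ∑[ j < n ] f j
∑-∣ˢ zero    f k∣f = ∣ˢ0
∑-∣ˢ (suc n) f k∣f = Signed.∣m∣n⇒∣m+n (∑-∣ˢ n f (λ j j<n → k∣f j (ℕₚ.m<n⇒m<1+n j<n))) (k∣f n ℕₚ.≤-refl)

frobenius : ∀ {p} → Prime p → ¬ 2 ∣ℕ p → ∀ m f → powFactor m p f ≈ [1-q^ p * m ] f mod p
frobenius {zero}  _       p-odd = ⊥-elim (p-odd (2 ∣0))
frobenius {suc q} p-prime p-odd m f = congruent p∣difference
  where
  p = suc q
  p∣difference : ∀ x → + p ∣ˢ powFactor m p f x - [1-q^ p * m ] f x
  p∣difference x = subst (_ ∣ˢ_) (sym outer-terms-cancel) (∑-∣ˢ q (t ∘ suc) p∣inner-term)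
    where
    t : ℕ → ℤ
    t j = binomialTerm m p f j x
    p∣inner-term : ∀ j → j < q → + p ∣ˢ t (suc j)
    p∣inner-term j j<q = Signed.∣m⇒∣m*n (shift (suc j * m) f x)
      (Signed.∣n⇒∣m*n (negOnePowℕ (suc j)) (Signed.∣ᵤ⇒∣ (prime⇒p∣pCj p-prime (s≤s z≤n) (s≤s j<q))))
    cancel : ∀ a b s → + 1 ℤ.* + 1 ℤ.* a ℤ.+ (s ℤ.+ - + 1 ℤ.* + 1 ℤ.* b) - (a - b) ≡ s
    cancel = solve-∀
    outer-terms-cancel : powFactor m p f x - [1-q^ p * m ] f x ≡ ∑[ j < q ] t (suc j)
    outer-terms-cancel = begin
      powFactor m p f x - [1-q^ p * m ] f x
        ≡⟨ cong (_- [1-q^ p * m ] f x) (trans (powFactor-binomial m p f x) (∑-first p t)) ⟩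
      t 0 ℤ.+ (∑[ j < q ] t (suc j) ℤ.+ t p) - [1-q^ p * m ] f x
        ≡⟨ cong₂ (λ s c → t 0 ℤ.+ (∑[ j < q ] t (suc j) ℤ.+ s ℤ.* + c ℤ.* shift (p * m) f x) - [1-q^ p * m ] f x)
                 (negOnePowℕ-odd p p-odd) (nCn≡1 p) ⟩
      + 1 ℤ.* + 1 ℤ.* f x ℤ.+ (∑[ j < q ] t (suc j) ℤ.+ - + 1 ℤ.* + 1 ℤ.* shift (p * m) f x) - (f x - shift (p * m) f x)
        ≡⟨ cancel (f x) (shift (p * m) f x) (∑[ j < q ] t (suc j)) ⟩
      ∑[ j < q ] t (suc j) ∎

powFactor-+ : ∀ m a b f → powFactor m (a + b) f ≡ powFactor m a (powFactor m b f)
powFactor-+ m zero    b f = refl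
powFactor-+ m (suc a) b f = cong (mulFactor m) (powFactor-+ m a b f)

prodUpTo-≈ : ∀ {p} → Prime p → ¬ 2 ∣ℕ p → ∀ N →
             prodUpTo (2 * p) N ≈ eulerProduct p N (eulerProduct p N oneS) mod p
prodUpTo-≈ p-prime p-odd zero    = ≗⇒≈ (λ _ → refl)
prodUpTo-≈ {p} p-prime p-odd (suc N) =
  ≈-trans (≗⇒≈ (λ x → cong (λ F → F x) two-halves))
  (≈-trans (frobenius p-prime p-odd m (powFactor m p P))
  (≈-trans ([1-q^]-≈ (p * m) (frobenius p-prime p-odd m P))
  (≈-trans ([1-q^]-≈ (p * m) ([1-q^]-≈ (p * m) (prodUpTo-≈ p-prime p-odd N)))
  (≗⇒≈ ([1-q^]-cong (p * m) ([1-q^]-factorsFrom (p * m) p 0 N (eulerProduct p N oneS)))))))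
  where
  m = suc N
  P = prodUpTo (2 * p) N
  two-halves : powFactor m (2 * p) P ≡ powFactor m p (powFactor m p P)
  two-halves = trans (cong (λ k → powFactor m (p + k) P) (ℕₚ.+-identityʳ p)) (powFactor-+ m p p P)

negOnePow-1+ : ∀ z → negOnePow (+ 1 ℤ.+ z) ≡ - negOnePow z
negOnePow-1+ (+ n)          = refl
negOnePow-1+ -[1+ zero ]    = refl
negOnePow-1+ -[1+ suc n ]   = sym (ℤₚ.neg-involutive (negOnePowℕ (suc n)))

negOnePow-neg : ∀ z → negOnePow (- z) ≡ negOnePow z
negOnePow-neg z = cong negOnePowℕ (ℤₚ.∣-i∣≡∣i∣ z)

negOnePow-+-pos : ∀ r n → negOnePow (r ℤ.+ + n) ≡ negOnePow r ℤ.* negOnePowℕ n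
negOnePow-+-pos r zero    = trans (cong negOnePow (ℤₚ.+-identityʳ r)) (sym (ℤₚ.*-identityʳ (negOnePow r)))
negOnePow-+-pos r (suc n) = begin
  negOnePow (r ℤ.+ (+ 1 ℤ.+ + n))        ≡⟨ cong negOnePow (swap r (+ n)) ⟩
  negOnePow (+ 1 ℤ.+ (r ℤ.+ + n))        ≡⟨ negOnePow-1+ (r ℤ.+ + n) ⟩
  - negOnePow (r ℤ.+ + n)                ≡⟨ cong -_ (negOnePow-+-pos r n) ⟩
  - (negOnePow r ℤ.* negOnePowℕ n)       ≡⟨ ℤₚ.neg-distribʳ-* (negOnePow r) (negOnePowℕ n) ⟩
  negOnePow r ℤ.* negOnePowℕ (suc n)     ∎
  where
  swap : ∀ r a → r ℤ.+ (+ 1 ℤ.+ a) ≡ + 1 ℤ.+ (r ℤ.+ a)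
  swap = solve-∀

negOnePow-+ : ∀ r s → negOnePow (r ℤ.+ s) ≡ negOnePow r ℤ.* negOnePow s
negOnePow-+ r (+ n)     = negOnePow-+-pos r n
negOnePow-+ r -[1+ n ]  = begin
  negOnePow (r ℤ.+ -[1+ n ])                ≡⟨ cong negOnePow (flip r (+ suc n)) ⟩
  negOnePow (- (- r ℤ.+ + suc n))           ≡⟨ negOnePow-neg (- r ℤ.+ + suc n) ⟩
  negOnePow (- r ℤ.+ + suc n)               ≡⟨ negOnePow-+-pos (- r) (suc n) ⟩
  negOnePow (- r) ℤ.* negOnePowℕ (suc n)    ≡⟨ cong (ℤ._* negOnePowℕ (suc n)) (negOnePow-neg r) ⟩
  negOnePow r ℤ.* negOnePow -[1+ n ]        ∎
  where
  flip : ∀ r a → r ℤ.+ - a ≡ - (- r ℤ.+ a)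
  flip = solve-∀

sumℤ-++ : ∀ xs ys → sumℤ (xs ++ ys) ≡ sumℤ xs ℤ.+ sumℤ ys
sumℤ-++ []       ys = sym (ℤₚ.+-identityˡ (sumℤ ys))
sumℤ-++ (x ∷ xs) ys = trans (cong (ℤ._+_ x) (sumℤ-++ xs ys)) (sym (ℤₚ.+-assoc x (sumℤ xs) (sumℤ ys)))

sumℤ-concatMap : ∀ {A : Set} (f : A → List ℤ) xs → sumℤ (concatMap f xs) ≡ sumℤ (map (sumℤ ∘ f) xs)
sumℤ-concatMap f []       = refl
sumℤ-concatMap f (x ∷ xs) = trans (sumℤ-++ (f x) (concatMap f xs)) (cong (ℤ._+_ (sumℤ (f x))) (sumℤ-concatMap f xs))

sumℤ-applyUpTo : ∀ (f : ℕ → ℤ) n → sumℤ (applyUpTo f n) ≡ ∑[ i < n ] f i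
sumℤ-applyUpTo f zero    = refl
sumℤ-applyUpTo f (suc n) = trans (cong (ℤ._+_ (f 0)) (sumℤ-applyUpTo (f ∘ suc) n)) (sym (∑-first n f))

∑-centered : ∀ n F → ∑[ i < suc (2 * n) ] F (+ i - + n) ≡ ∑± n F
∑-centered zero    F = ℤₚ.+-identityˡ (F (+ 0))
∑-centered (suc n) F = begin
  ∑[ i < suc (2 * suc n) ] G i
    ≡⟨ cong (λ k → ∑[ i < suc k ] G i) (ℕₚ.*-suc 2 n) ⟩
  ∑[ i < suc (suc (suc (2 * n))) ] G i
    ≡⟨ ∑-first (suc (suc (2 * n))) G ⟩
  F -[1+ n ] ℤ.+ (∑[ i < suc (2 * n) ] G (suc i) ℤ.+ G (suc (suc (2 * n))))
    ≡⟨ cong₂ (λ a b → F -[1+ n ] ℤ.+ (a ℤ.+ F b))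
             (trans (∑-cong (suc (2 * n)) (λ i _ → cong F (shift-index (+ i) (+ n)))) (∑-centered n F))
             (trans (cong (λ k → + k - + suc n) (ℕ-lemma n)) (cancel (+ suc n))) ⟩
  F -[1+ n ] ℤ.+ (∑± n F ℤ.+ F (+ suc n))
    ≡⟨ rotate (F -[1+ n ]) (∑± n F) (F (+ suc n)) ⟩
  ∑± (suc n) F ∎
  where
  G : ℕ → ℤ
  G i = F (+ i - + suc n)
  shift-index : ∀ a b → (+ 1 ℤ.+ a) - (+ 1 ℤ.+ b) ≡ a - b
  shift-index = solve-∀
  ℕ-lemma : ∀ n → suc (suc (2 * n)) ≡ suc n + suc n
  ℕ-lemma = ℕ-Ring.solve-∀
  cancel : ∀ a → (a ℤ.+ a) - a ≡ a
  cancel = solve-∀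
  rotate : ∀ a s b → a ℤ.+ (s ℤ.+ b) ≡ s ℤ.+ (b ℤ.+ a)
  rotate = solve-∀

sumℤ-rangeℤ : ∀ n F → sumℤ (map F (rangeℤ n)) ≡ ∑± n F
sumℤ-rangeℤ n F = begin
  sumℤ (map F (map index (upTo (suc (2 * n)))))   ≡⟨ cong sumℤ (map-∘ {g = F} {f = index} (upTo (suc (2 * n)))) ⟨
  sumℤ (map (F ∘ index) (upTo (suc (2 * n))))     ≡⟨ cong sumℤ (map-upTo (F ∘ index) (suc (2 * n))) ⟩
  sumℤ (applyUpTo (F ∘ index) (suc (2 * n)))      ≡⟨ sumℤ-applyUpTo (F ∘ index) (suc (2 * n)) ⟩
  ∑[ i < suc (2 * n) ] F (index i)                ≡⟨ ∑-centered n F ⟩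
  ∑± n F                                          ∎
  where
  index : ℕ → ℤ
  index i = + i - + n

pentSummand : ℕ → ℕ → ℤ → ℤ → ℤ
pentSummand p n r s = if does (+ n ℤ.≟ + p ℤ.* (pent r ℤ.+ pent s)) then negOnePow (r ℤ.+ s) else + 0

pentSum≡∑± : ∀ p n → pentSum p n ≡ ∑± n (λ r → ∑± n (pentSummand p n r))
pentSum≡∑± p n = begin
  sumℤ (concatMap (λ r → map (pentSummand p n r) (rangeℤ n)) (rangeℤ n))
    ≡⟨ sumℤ-concatMap (λ r → map (pentSummand p n r) (rangeℤ n)) (rangeℤ n) ⟩
  sumℤ (map (λ r → sumℤ (map (pentSummand p n r) (rangeℤ n))) (rangeℤ n))
    ≡⟨ sumℤ-rangeℤ n _ ⟩
  ∑± n (λ r → sumℤ (map (pentSummand p n r) (rangeℤ n)))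
    ≡⟨ ∑±-cong n (λ r → sumℤ-rangeℤ n (pentSummand p n r)) ⟩
  ∑± n (λ r → ∑± n (pentSummand p n r)) ∎

signed-indicator : ∀ b r s → negOnePow r ℤ.* (negOnePow s ℤ.* (if b then + 1 else + 0))
                           ≡ (if b then negOnePow (r ℤ.+ s) else + 0)
signed-indicator true  r s = trans (cong (negOnePow r ℤ.*_) (ℤₚ.*-identityʳ (negOnePow s))) (sym (negOnePow-+ r s))
signed-indicator false r s = trans (cong (negOnePow r ℤ.*_) (ℤₚ.*-zeroʳ (negOnePow s))) (ℤₚ.*-zeroʳ (negOnePow r))

coefficient-term : ∀ p n r s →
  negOnePow r ℤ.* (negOnePow s ℤ.* shift (p * pentℕ r + p * pentℕ s) oneS n) ≡ pentSummand p n r s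
coefficient-term p n r s = begin
  negOnePow r ℤ.* (negOnePow s ℤ.* shift (p * pentℕ r + p * pentℕ s) oneS n)
    ≡⟨ cong (λ c → negOnePow r ℤ.* (negOnePow s ℤ.* c)) (shift-oneS (p * pentℕ r + p * pentℕ s) n) ⟩
  negOnePow r ℤ.* (negOnePow s ℤ.* (if does (+ n ℤ.≟ + (p * pentℕ r + p * pentℕ s)) then + 1 else + 0))
    ≡⟨ cong (λ z → negOnePow r ℤ.* (negOnePow s ℤ.* (if does (+ n ℤ.≟ z) then + 1 else + 0))) exponent ⟩
  negOnePow r ℤ.* (negOnePow s ℤ.* (if does (+ n ℤ.≟ + p ℤ.* (pent r ℤ.+ pent s)) then + 1 else + 0))
    ≡⟨ signed-indicator _ r s ⟩
  pentSummand p n r s ∎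
  where
  exponent : + (p * pentℕ r + p * pentℕ s) ≡ + p ℤ.* (pent r ℤ.+ pent s)
  exponent = begin
    + (p * pentℕ r + p * pentℕ s)    ≡⟨ cong +_ (ℕₚ.*-distribˡ-+ p (pentℕ r) (pentℕ s)) ⟨
    + (p * (pentℕ r + pentℕ s))      ≡⟨ ℤₚ.pos-* p (pentℕ r + pentℕ s) ⟩
    + p ℤ.* (+ pentℕ r ℤ.+ + pentℕ s) ≡⟨ cong₂ (λ a b → + p ℤ.* (a ℤ.+ b)) (pent≡pentℕ r) (pent≡pentℕ s) ⟨
    + p ℤ.* (pent r ℤ.+ pent s)      ∎

eulerSquare-coefficient : ∀ p .{{_ : NonZero p}} n →
                          eulerProduct p n (eulerProduct p n oneS) n ≡ pentSum p n
eulerSquare-coefficient p n = begin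
  eulerProduct p n E n
    ≡⟨ pentagonal p E {n} ℕₚ.≤-refl ⟩
  ∑± n (λ r → negOnePow r ℤ.* shift (p * pentℕ r) E n)
    ≡⟨ ∑±-cong n inner-sum ⟩
  ∑± n (λ r → ∑± n (pentSummand p n r))
    ≡⟨ pentSum≡∑± p n ⟨
  pentSum p n ∎
  where
  E = eulerProduct p n oneS
  t : ℤ → Series
  t s M = negOnePow s ℤ.* shift (p * pentℕ s) oneS M
  inner-sum : ∀ r → negOnePow r ℤ.* shift (p * pentℕ r) E n ≡ ∑± n (pentSummand p n r)
  inner-sum r = begin
    negOnePow r ℤ.* shift (p * pentℕ r) E n
      ≡⟨ cong (negOnePow r ℤ.*_) (shift-agree (p * pentℕ r) (λ M M≤n → pentagonal p oneS M≤n)) ⟩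
    negOnePow r ℤ.* shift (p * pentℕ r) (λ M → ∑± n (λ s → t s M)) n
      ≡⟨ cong (negOnePow r ℤ.*_) (shift-∑± (p * pentℕ r) n t n) ⟩
    negOnePow r ℤ.* ∑± n (λ s → shift (p * pentℕ r) (t s) n)
      ≡⟨ ∑±-*-distribˡ n (negOnePow r) _ ⟩
    ∑± n (λ s → negOnePow r ℤ.* shift (p * pentℕ r) (t s) n)
      ≡⟨ ∑±-cong n (λ s → cong (negOnePow r ℤ.*_) (trans
           (shift-map (p * pentℕ r) (negOnePow s ℤ.*_) (ℤₚ.*-zeroʳ (negOnePow s)) n)
           (cong (negOnePow s ℤ.*_) (shift-shift (p * pentℕ r) (p * pentℕ s) oneS n)))) ⟩
    ∑± n (λ s → negOnePow r ℤ.* (negOnePow s ℤ.* shift (p * pentℕ r + p * pentℕ s) oneS n))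
      ≡⟨ ∑±-cong n (coefficient-term p n r) ⟩
    ∑± n (pentSummand p n r) ∎

mainTheorem16 : (p : ℕ) → Prime p → ¬ (2 ∣ℕ p) → (n : ℕ) →
    (+ p) ∣ (τ (2 * p) (suc n) - pentSum p n)
mainTheorem16 p p-prime p-odd n =
  Signed.∣⇒∣ᵤ (subst (λ c → + p ∣ˢ τ (2 * p) (suc n) - c) (eulerSquare-coefficient p n) τ≈E²)
  where
  instance _ = prime⇒nonZero p-prime
  τ≈E² : + p ∣ˢ τ (2 * p) (suc n) - eulerProduct p n (eulerProduct p n oneS) n
  τ≈E² = _≈_mod_.∣-difference (prodUpTo-≈ p-prime p-odd n) n
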